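{- Let $b,c$ be integers with $n=b^2+c^2$ prime and $\{4,4\}_{(b,c)}$ chiral, let $t$ be an integer with $2\le t\le n-2$, $t^2\equiv-1\pmod n$, $t\equiv 0$ or $3\pmod 4$, and let $\sigma_1,\sigma_2,\tau$ be the permutations of $V=\{1,\dots,4n\}\cup\{1',\dots,(4n)'\}$ given by (unprimed entries modulo $4n$ in $\{1,\dots,4n\}$) $\sigma_1=\prod_{i=0}^{n-1}(4i+1,4i+2,4i+3,4i+4)$, $\sigma_2=\prod_{i=0}^{n-1}(4i+1,4i+4t+2,4i+4t+7,4i+8)$, both acting on primed points by $(j')\sigma=(j\sigma)'$, and $\tau=(5,(4t+1)')(6,(4t+4)')(7,(4t+3)')(8,(4t+2)')(4t+1,5')(4t+2,8')(4t+3,7')(4t+4,6')\prod_{0\le i\le n-1,\ i\ne1,t}(4i+1,(4i+1)')(4i+2,(4i+4)')(4i+3,(4i+3)')(4i+4,(4i+2)')$. Let $\Gamma=\langle\sigma_1,\sigma_2,\tau\rangle$ (the automorphism group of the chiral $4$-polytope $\mathcal P$ with abstract rotations $\sigma_1,\sigma_2,\sigma_2^{ -1}\tau$). For $k\in\{1,2,3,4\}$ let class $k$ be $\{4i+k\}$ and class $k'$ be $\{(4i+k)'\}$ ($0\le i\le n-1$), and let $\Lambda$ be the subgroup of $\Gamma$ stabilizing each of these eight classes setwise. Then $\Lambda$ is isomorphic to a subgroup of $A_n\times A_n$.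
   Context: $\{4,4\}_{(b,c)}$ is the toroidal quotient of the square tessellation of the plane by the translations along $(b,c)$ and $(-c,b)$. $A_n$ is the alternating group of degree $n$. -}

module Defs where

open import Data.Nat using (ℕ; zero; suc; _+_; _*_; _∸_; _<_; _<ᵇ_; NonZero)
open import Data.Nat.DivMod using (_mod_; _%_)
open import Data.Nat.Divisibility using (_∣_)
open import Data.Integer as ℤ using (ℤ; ∣_∣)
open import Data.Fin using (Fin; toℕ; _≟_)
open import Data.Fin.Patterns using (0F; 1F; 2F; 3F)
open import Data.Fin.Permutation using (Permutation′; _⟨$⟩ʳ_; _∘ₚ_)
open import Data.Product using (Σ; ∃; _×_; _,_; proj₁; proj₂)
open import Data.Sum using (_⊎_)
open import Data.List using (List; []; _∷_; length; filter; allFin; concatMap; map)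
open import Data.Bool using (Bool; true; false; if_then_else_)
open import Relation.Nullary using (¬_; does)
open import Relation.Binary.PropositionalEquality using (_≡_; _≢_)

-- The toroidal map {4,4}_(b,c) is chiral iff b c (b - c) ≠ 0 (up to the
-- symmetries (b,c) ↦ (±b,±c),(c,b) of the parameters), i.e. iff
-- b ≠ 0, c ≠ 0 and |b| ≠ |c|  (Coxeter–Moser).

Chiral44 : ℤ → ℤ → Set
Chiral44 b c = (b ≢ ℤ.0ℤ) × (c ≢ ℤ.0ℤ) × (∣ b ∣ ≢ ∣ c ∣)

-- The point (un , i , k) (i : Fin n, k : Fin 4) encodes the integer 4i+k+1,
-- and (pr , i , k) encodes (4i+k+1)'.  So "class k+1" = {(un,i,k)} and
-- "class (k+1)'" = {(pr,i,k)}.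

data Side : Set where
  un pr : Side

Pt : ℕ → Set
Pt n = Side × Fin n × Fin 4

_⊕_ : ∀ {n} .{{_ : NonZero n}} → Fin n → ℕ → Fin n
_⊕_ {n} i a = (toℕ i + a) mod n

σ₁ : ∀ n .{{_ : NonZero n}} → Pt n → Pt n
σ₁ n (s , i , 0F) = (s , i , 1F)
σ₁ n (s , i , 1F) = (s , i , 2F)
σ₁ n (s , i , 2F) = (s , i , 3F)
σ₁ n (s , i , 3F) = (s , i , 0F)

σ₁⁻¹ : ∀ n .{{_ : NonZero n}} → Pt n → Pt n
σ₁⁻¹ n (s , i , 0F) = (s , i , 3F)
σ₁⁻¹ n (s , i , 1F) = (s , i , 0F)
σ₁⁻¹ n (s , i , 2F) = (s , i , 1F)
σ₁⁻¹ n (s , i , 3F) = (s , i , 2F)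

-- σ₂ = ∏ (4i+1, 4i+4t+2, 4i+4t+7, 4i+8)   (entries mod 4n), i.e. the cycle
-- (i,0) → (i+t,1) → (i+t+1,2) → (i+1,3) → (i,0) on (block, position).
σ₂ : ∀ n .{{_ : NonZero n}} → ℕ → Pt n → Pt n
σ₂ n t (s , j , 0F) = (s , j ⊕ t , 1F)
σ₂ n t (s , j , 1F) = (s , j ⊕ 1 , 2F)
σ₂ n t (s , j , 2F) = (s , j ⊕ (n ∸ t) , 3F)
σ₂ n t (s , j , 3F) = (s , j ⊕ (n ∸ 1) , 0F)

σ₂⁻¹ : ∀ n .{{_ : NonZero n}} → ℕ → Pt n → Pt n
σ₂⁻¹ n t (s , j , 0F) = (s , j ⊕ 1 , 3F)
σ₂⁻¹ n t (s , j , 1F) = (s , j ⊕ (n ∸ t) , 0F)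
σ₂⁻¹ n t (s , j , 2F) = (s , j ⊕ (n ∸ 1) , 1F)
σ₂⁻¹ n t (s , j , 3F) = (s , j ⊕ t , 2F)

ρ : Fin 4 → Fin 4
ρ 0F = 0F
ρ 1F = 3F
ρ 2F = 2F
ρ 3F = 1F

swapSide : Side → Side
swapSide un = pr
swapSide pr = un

-- τ = (5,(4t+1)')(6,(4t+4)')(7,(4t+3)')(8,(4t+2)')
--     (4t+1,5')(4t+2,8')(4t+3,7')(4t+4,6')
--     ∏_{i ≠ 1,t} (4i+1,(4i+1)')(4i+2,(4i+4)')(4i+3,(4i+3)')(4i+4,(4i+2)')
-- i.e. (s,i,k) ↦ (s', i*, ρ k) where i* = t if i = 1, i* = 1 if i = t, else i.
τ : ∀ n .{{_ : NonZero n}} → ℕ → Pt n → Pt n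
τ n t (s , i , k) =
  if does (toℕ i Data.Nat.≟ 1) then (swapSide s , t mod n , ρ k)
  else if does (toℕ i Data.Nat.≟ t) then (swapSide s , 1 mod n , ρ k)
  else (swapSide s , i , ρ k)

-- Γ = ⟨σ₁, σ₂, τ⟩ : permutations of V given by words in the generators
-- and their inverses (τ is an involution).  Permutations act on the
-- right as in the paper: x (g h) = (x g) h.

data Gen : Set where
  g-σ₁ g-σ₁⁻¹ g-σ₂ g-σ₂⁻¹ g-τ : Gen

⟦_⟧g : Gen → ∀ n .{{_ : NonZero n}} → ℕ → Pt n → Pt n
⟦ g-σ₁ ⟧g n t = σ₁ n
⟦ g-σ₁⁻¹ ⟧g n t = σ₁⁻¹ n
⟦ g-σ₂ ⟧g n t = σ₂ n t
⟦ g-σ₂⁻¹ ⟧g n t = σ₂⁻¹ n t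
⟦ g-τ ⟧g n t = τ n t

evalWord : ∀ n .{{_ : NonZero n}} → ℕ → List Gen → Pt n → Pt n
evalWord n t [] x = x
evalWord n t (g ∷ w) x = evalWord n t w (⟦ g ⟧g n t x)

InΓ : ∀ n .{{_ : NonZero n}} → ℕ → (Pt n → Pt n) → Set
InΓ n t f = Σ (List Gen) λ w → ∀ x → f x ≡ evalWord n t w x

StabClass : ∀ {n} → (Pt n → Pt n) → Side → Fin 4 → Set
StabClass {n} f s k =
  (∀ (i : Fin n) → proj₁ (f (s , i , k)) ≡ s × proj₂ (proj₂ (f (s , i , k))) ≡ k)
  × (∀ (j : Fin n) → Σ (Fin n) λ i → f (s , i , k) ≡ (s , j , k))

InΛ : ∀ n .{{_ : NonZero n}} → ℕ → (Pt n → Pt n) → Set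
InΛ n t f = InΓ n t f × (∀ s k → StabClass f s k)

inversions : ∀ {n} → Permutation′ n → ℕ
inversions {n} π =
  length (filter (λ p → toℕ (π ⟨$⟩ʳ proj₂ p) Data.Nat.<? toℕ (π ⟨$⟩ʳ proj₁ p))
    (filter (λ p → toℕ (proj₁ p) Data.Nat.<? toℕ (proj₂ p))
      (concatMap (λ i → map (λ j → (i , j)) (allFin n)) (allFin n))))

IsEven : ∀ {n} → Permutation′ n → Set
IsEven π = inversions π % 2 ≡ 0

_≈ₚ_ : ∀ {n} → Permutation′ n → Permutation′ n → Set
π ≈ₚ ρ' = ∀ i → π ⟨$⟩ʳ i ≡ ρ' ⟨$⟩ʳ i

-- Λ is isomorphic to a subgroup of A_n × A_n: there is an injective group
-- homomorphism Λ → A_n × A_n (its image is then the required subgroup).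
-- Permutations of Fin n also act on the right: x (π ρ) = (x π) ρ, i.e. the
-- product π·ρ is  π ∘ₚ ρ  (stdlib's _∘ₚ_ applies its left argument first).
EmbedsInAn×An : ∀ n .{{_ : NonZero n}} → ℕ → Set
EmbedsInAn×An n t =
  Σ ((f : Pt n → Pt n) → InΛ n t f → Permutation′ n × Permutation′ n) λ φ →
    (∀ f (p : InΛ n t f) → IsEven (proj₁ (φ f p)) × IsEven (proj₂ (φ f p)))
    × (∀ f g (p : InΛ n t f) (q : InΛ n t g) → (∀ x → f x ≡ g x) →
         proj₁ (φ f p) ≈ₚ proj₁ (φ g q) × proj₂ (φ f p) ≈ₚ proj₂ (φ g q))
    × (∀ f g h (p : InΛ n t f) (q : InΛ n t g) (r : InΛ n t h) →
         (∀ x → h x ≡ g (f x)) →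
         proj₁ (φ h r) ≈ₚ (proj₁ (φ f p) ∘ₚ proj₁ (φ g q))
         × proj₂ (φ h r) ≈ₚ (proj₂ (φ f p) ∘ₚ proj₂ (φ g q)))
    × (∀ f g (p : InΛ n t f) (q : InΛ n t g) →
         proj₁ (φ f p) ≈ₚ proj₁ (φ g q) → proj₂ (φ f p) ≈ₚ proj₂ (φ g q) →
         ∀ x → f x ≡ g x)

{-# OPTIONS --safe #-}

-- Every generator of Γ maps each class (s, k) onto a class, acting on the block index i ∈ ℤ/n
-- by the identity or a translation (σ₁, σ₂), or by the transposition of 1 and t (τ, which also
-- exchanges primed and unprimed points).  So the restriction of a word to a class is a product
-- of such maps with one transposition for each τ in the word.  An element of Λ keeps unprimed
-- points unprimed, so its word has an even number of τ's; and translations are even, since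
-- their n-th power is trivial and n is odd.  Hence every restriction of an element of Λ lies
-- in A_n.  Moreover (s, i, k) ↦ (k mod 2, i or 1 + t − i according as k < 2 or not) is
-- Γ-equivariant, so the restriction of an element of Λ to any class is the conjugate of its
-- restriction to class 1 or class 2 by the identity or by the reflection i ↦ 1 + t − i.
-- Hence f ↦ (f restricted to class 1, f restricted to class 2) embeds Λ in A_n × A_n.

module Submission where

open import Defs
open import Data.Bool using (Bool; true; false; if_then_else_)
open import Data.Bool.Properties using (if-float)
open import Data.Empty using (⊥-elim)
open import Data.Fin using (Fin; zero; suc; toℕ; _≟_)
open import Data.Fin.Patterns using (0F; 1F; 2F; 3F)
open import Data.Fin.Permutation using (Permutation′; permutation; _⟨$⟩ʳ_; _∘ₚ_; _≈_; id)
open import Data.Fin.Properties using (toℕ-injective; toℕ-fromℕ<; toℕ<n)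
open import Data.Integer using (ℤ; +_) renaming (_+_ to _+ℤ_; _*_ to _*ℤ_)
open import Data.List using (List; []; _∷_; length; filter; map; concatMap; tabulate; allFin)
open import Data.List.Properties using (map-concatMap; map-∘)
open import Data.Nat
  using (ℕ; zero; suc; _+_; _*_; _∸_; _<_; _≤_; s≤s; _<?_; NonZero; >-nonZero⁻¹; parity)
  renaming (_≟_ to _≟ℕ_)
open import Data.Nat.DivMod
  using (_%_; _mod_; %-distribˡ-+; m%n%n≡m%n; [m+kn]%n≡m%n; n%n≡0; m<n⇒m%n≡m; m%n≤n; m%n<n)
open import Data.Nat.Divisibility using (_∣_; divides; ∣-refl; ∣m∣n⇒∣m+n; ∣n⇒∣m*n; n∣m⇒m%n≡0)
open import Data.Nat.ListAction using () renaming (sum to listSum)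
open import Data.Nat.ListAction.Properties using (sum-++)
open import Data.Nat.Primality using (Prime; prime⇒irreducible)
open import Data.Nat.Properties
  using (+-0-commutativeMonoid; +-commutativeSemigroup; +-comm; +-assoc; +-identityʳ; *-comm;
         *-identityˡ; *-distribʳ-+; *-distribˡ-+; *-cancelˡ-≡; m+[n∸m]≡n; m∸n+n≡m;
         <⇒≤; <⇒≢; <-trans; <-asym; <-irrefl; ≮⇒≥; ≤-trans; ≤-antisym; n≮0; m≤n⇒m≤1+n)
open import Algebra.Properties.CommutativeMonoid.Sum +-0-commutativeMonoid
  using (sum; ∑-distrib-+; ∑-comm; sum-permute; sum-cong-≗)
open import Algebra.Properties.CommutativeSemigroup +-commutativeSemigroup using (interchange)
open import Data.Parity.Base as ℙ using (Parity; 0ℙ; 1ℙ)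
open import Data.Parity.Properties as ℙₚ using (+-homo-+; *-homo-*; p+p≡0ℙ)
open import Data.Product using (_×_; _,_; proj₁; proj₂)
open import Data.Sum using (_⊎_; inj₂)
open import Function using (_∘_; flip)
open import Function.Bundles using (Injection)
open import Function.Properties.Inverse using (↔⇒↣)
open import Level using (0ℓ)
open import Relation.Binary.PropositionalEquality
open import Relation.Nullary using (¬_; does; yes; no)
open import Relation.Nullary.Decidable using (dec-true; dec-false)
open import Relation.Unary using (Pred; Decidable)

open ≡-Reasoning

χ : Bool → ℕ
χ b = if b then 1 else 0

length-filter-filter : ∀ {A : Set} {P Q : Pred A 0ℓ} (P? : Decidable P) (Q? : Decidable Q) xs →
  length (filter Q? (filter P? xs)) ≡ listSum (map (λ x → χ (does (P? x)) * χ (does (Q? x))) xs)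
length-filter-filter P? Q? [] = refl
length-filter-filter P? Q? (x ∷ xs) with does (P? x)
... | false = length-filter-filter P? Q? xs
... | true with does (Q? x)
...   | false = length-filter-filter P? Q? xs
...   | true = cong suc (length-filter-filter P? Q? xs)

sum-concatMap : ∀ {A : Set} (g : A → List ℕ) xs →
  listSum (concatMap g xs) ≡ listSum (map (listSum ∘ g) xs)
sum-concatMap g [] = refl
sum-concatMap g (x ∷ xs) =
  trans (sum-++ (g x) (concatMap g xs)) (cong (_+_ (listSum (g x))) (sum-concatMap g xs))

sum-map-tabulate : ∀ {A : Set} {m} (h : A → ℕ) (g : Fin m → A) →
  listSum (map h (tabulate g)) ≡ sum (h ∘ g)
sum-map-tabulate {m = zero} h g = refl
sum-map-tabulate {m = suc m} h g = cong (_+_ (h (g zero))) (sum-map-tabulate h (g ∘ suc))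

sum-even : ∀ {m} (f : Fin m → ℕ) → (∀ i → 2 ∣ f i) → 2 ∣ sum f
sum-even {zero} f even = divides 0 refl
sum-even {suc m} f even = ∣m∣n⇒∣m+n (even zero) (sum-even (f ∘ suc) (even ∘ suc))

parity≡0ℙ⇒2∣ : ∀ m → parity m ≡ 0ℙ → 2 ∣ m
parity≡0ℙ⇒2∣ zero _ = divides 0 refl
parity≡0ℙ⇒2∣ (suc zero) ()
parity≡0ℙ⇒2∣ (suc (suc m)) e = ∣m∣n⇒∣m+n ∣-refl (parity≡0ℙ⇒2∣ m e)

2∣⇒parity≡0ℙ : ∀ {m} → 2 ∣ m → parity m ≡ 0ℙ
2∣⇒parity≡0ℙ (divides q refl) = trans (*-homo-* q 2) (ℙₚ.*-zeroʳ (parity q))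

¬2∣⇒parity≡1ℙ : ∀ {m} → ¬ 2 ∣ m → parity m ≡ 1ℙ
¬2∣⇒parity≡1ℙ {m} odd with parity m in eq
... | 0ℙ = ⊥-elim (odd (parity≡0ℙ⇒2∣ m eq))
... | 1ℙ = refl

2∣⇒parity-rearrange : ∀ a b c → 2 ∣ a + b + c → parity b ≡ parity a ℙ.+ parity c
2∣⇒parity-rearrange a b c even = ℙ-rearrange (parity a) (parity b) (parity c) (begin
  parity a ℙ.+ parity b ℙ.+ parity c ≡⟨ cong (ℙ._+ parity c) (+-homo-+ a b) ⟨
  parity (a + b) ℙ.+ parity c        ≡⟨ +-homo-+ (a + b) c ⟨
  parity (a + b + c)                 ≡⟨ 2∣⇒parity≡0ℙ even ⟩
  0ℙ                                 ∎)
  where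
  ℙ-rearrange : ∀ x y z → x ℙ.+ y ℙ.+ z ≡ 0ℙ → y ≡ x ℙ.+ z
  ℙ-rearrange 0ℙ 0ℙ 0ℙ _ = refl
  ℙ-rearrange 0ℙ 1ℙ 1ℙ _ = refl
  ℙ-rearrange 1ℙ 0ℙ 1ℙ _ = refl
  ℙ-rearrange 1ℙ 1ℙ 0ℙ _ = refl
  ℙ-rearrange 0ℙ 0ℙ 1ℙ ()
  ℙ-rearrange 0ℙ 1ℙ 0ℙ ()
  ℙ-rearrange 1ℙ 0ℙ 0ℙ ()
  ℙ-rearrange 1ℙ 1ℙ 1ℙ ()

-- Sign of a permutation

module _ {n : ℕ} where

  ⟦_<_⟧ : Fin n → Fin n → ℕ
  ⟦ i < j ⟧ = χ (does (toℕ i <? toℕ j))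

  ⟦<⟧-yes : ∀ {i j} → toℕ i < toℕ j → ⟦ i < j ⟧ ≡ 1
  ⟦<⟧-yes {i} {j} i<j = cong χ (dec-true (toℕ i <? toℕ j) i<j)

  ⟦<⟧-no : ∀ {i j} → ¬ toℕ i < toℕ j → ⟦ i < j ⟧ ≡ 0
  ⟦<⟧-no {i} {j} i≮j = cong χ (dec-false (toℕ i <? toℕ j) i≮j)

  ⟦<⟧-irrefl : ∀ i → ⟦ i < i ⟧ ≡ 0
  ⟦<⟧-irrefl i = ⟦<⟧-no {i} {i} (<-irrefl refl)

  ⟦<⟧-total : ∀ {i j} → i ≢ j → ⟦ i < j ⟧ + ⟦ j < i ⟧ ≡ 1
  ⟦<⟧-total {i} {j} i≢j with toℕ i <? toℕ j | toℕ j <? toℕ i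
  ... | yes i<j | yes j<i = ⊥-elim (<-asym i<j j<i)
  ... | yes i<j | no j≮i  = cong₂ _+_ (⟦<⟧-yes i<j) (⟦<⟧-no j≮i)
  ... | no i≮j  | yes j<i = cong₂ _+_ (⟦<⟧-no i≮j) (⟦<⟧-yes j<i)
  ... | no i≮j  | no j≮i  = ⊥-elim (i≢j (toℕ-injective (≤-antisym (≮⇒≥ j≮i) (≮⇒≥ i≮j))))

  Σ² : (Fin n → Fin n → ℕ) → ℕ
  Σ² S = sum λ i → sum (S i)

  Σ²-cong : ∀ {S T} → (∀ i j → S i j ≡ T i j) → Σ² S ≡ Σ² T
  Σ²-cong S≗T = sum-cong-≗ λ i → sum-cong-≗ (S≗T i)

  Σ²-+ : ∀ S T → Σ² (λ i j → S i j + T i j) ≡ Σ² S + Σ² T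
  Σ²-+ S T = trans (sum-cong-≗ λ i → ∑-distrib-+ (S i) (T i))
                   (∑-distrib-+ (λ i → sum (S i)) (λ i → sum (T i)))

  Σ²-flip : ∀ S → Σ² S ≡ Σ² (flip S)
  Σ²-flip = ∑-comm

  Σ²-permute : ∀ S (π : Permutation′ n) → Σ² (λ i j → S (π ⟨$⟩ʳ i) (π ⟨$⟩ʳ j)) ≡ Σ² S
  Σ²-permute S π = sym (trans (sum-cong-≗ λ i → sum-permute (S i) π)
                              (sum-permute (λ i → sum λ j → S i (π ⟨$⟩ʳ j)) π))

  Σ²-even : ∀ S → (∀ i j → 2 ∣ S i j) → 2 ∣ Σ² S
  Σ²-even S even = sum-even _ λ i → sum-even (S i) (even i)

  inversionCount : (Fin n → Fin n) → ℕ
  inversionCount f = Σ² λ i j → ⟦ i < j ⟧ * ⟦ f j < f i ⟧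

  inversions≡inversionCount : ∀ π → inversions π ≡ inversionCount (π ⟨$⟩ʳ_)
  inversions≡inversionCount π = begin
    inversions π
      ≡⟨ length-filter-filter (λ (i , j) → toℕ i <? toℕ j) (λ (i , j) → toℕ (f j) <? toℕ (f i)) pairs ⟩
    listSum (map c pairs)
      ≡⟨ cong listSum (map-concatMap c row (allFin n)) ⟩
    listSum (concatMap (map c ∘ row) (allFin n))
      ≡⟨ sum-concatMap (map c ∘ row) (allFin n) ⟩
    listSum (map (listSum ∘ map c ∘ row) (allFin n))
      ≡⟨ sum-map-tabulate (listSum ∘ map c ∘ row) (λ i → i) ⟩
    sum (λ i → listSum (map c (row i)))
      ≡⟨ sum-cong-≗ (λ i → trans (cong listSum (sym (map-∘ (allFin n))))
                                 (sum-map-tabulate (c ∘ (i ,_)) (λ j → j))) ⟩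
    inversionCount f ∎
    where
    f = π ⟨$⟩ʳ_
    row : Fin n → List (Fin n × Fin n)
    row i = map (i ,_) (allFin n)
    pairs = concatMap row (allFin n)
    c : Fin n × Fin n → ℕ
    c (i , j) = ⟦ i < j ⟧ * ⟦ f j < f i ⟧

  ⟦<⟧-*-cong : ∀ {i j x y} → (toℕ i < toℕ j → x ≡ y) → ⟦ i < j ⟧ * x ≡ ⟦ i < j ⟧ * y
  ⟦<⟧-*-cong {i} {j} {x} {y} x≡y with toℕ i <? toℕ j
  ... | yes i<j = cong (⟦ i < j ⟧ *_) (x≡y i<j)
  ... | no i≮j  = trans (cong (_* x) (⟦<⟧-no i≮j)) (sym (cong (_* y) (⟦<⟧-no i≮j)))

  ⟦<⟧-*-even : ∀ {i j} x → (toℕ i < toℕ j → 2 ∣ x) → 2 ∣ ⟦ i < j ⟧ * x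
  ⟦<⟧-*-even {i} {j} x even with toℕ i <? toℕ j
  ... | yes i<j = ∣n⇒∣m*n ⟦ i < j ⟧ (even i<j)
  ... | no i≮j  = subst (2 ∣_) (sym (cong (_* x) (⟦<⟧-no i≮j))) (divides 0 refl)

  Σ²-split : ∀ S → (∀ i → S i i ≡ 0) →
    Σ² (λ i j → ⟦ i < j ⟧ * S i j) + Σ² (λ i j → ⟦ i < j ⟧ * S j i) ≡ Σ² S
  Σ²-split S diag = begin
    Σ² (λ i j → ⟦ i < j ⟧ * S i j) + Σ² (λ i j → ⟦ i < j ⟧ * S j i)
      ≡⟨ cong (_+_ (Σ² (λ i j → ⟦ i < j ⟧ * S i j))) (Σ²-flip (λ i j → ⟦ j < i ⟧ * S i j)) ⟨
    Σ² (λ i j → ⟦ i < j ⟧ * S i j) + Σ² (λ i j → ⟦ j < i ⟧ * S i j)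
      ≡⟨ Σ²-+ (λ i j → ⟦ i < j ⟧ * S i j) (λ i j → ⟦ j < i ⟧ * S i j) ⟨
    Σ² (λ i j → ⟦ i < j ⟧ * S i j + ⟦ j < i ⟧ * S i j)
      ≡⟨ Σ²-cong both ⟩
    Σ² S ∎
    where
    both : ∀ i j → ⟦ i < j ⟧ * S i j + ⟦ j < i ⟧ * S i j ≡ S i j
    both i j with i ≟ j
    ... | yes refl = trans (cong (λ x → x * S i i + x * S i i) (⟦<⟧-irrefl i)) (sym (diag i))
    ... | no i≢j   = trans (sym (*-distribʳ-+ (S i j) ⟦ i < j ⟧ ⟦ j < i ⟧))
                       (trans (cong (_* S i j) (⟦<⟧-total i≢j)) (*-identityˡ (S i j)))

  Σ²-upper : ∀ S → (∀ i j → S i j ≡ S j i) → (∀ i → S i i ≡ 0) →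
    2 * Σ² (λ i j → ⟦ i < j ⟧ * S i j) ≡ Σ² S
  Σ²-upper S symm diag = begin
    2 * U                                 ≡⟨ cong (_+_ U) (+-identityʳ U) ⟩
    U + U                                 ≡⟨ cong (_+_ U) (Σ²-cong λ i j → cong (⟦ i < j ⟧ *_) (symm i j)) ⟩
    U + Σ² (λ i j → ⟦ i < j ⟧ * S j i)   ≡⟨ Σ²-split S diag ⟩
    Σ² S                                  ∎
    where U = Σ² (λ i j → ⟦ i < j ⟧ * S i j)

  inverts : (Fin n → Fin n) → Fin n → Fin n → ℕ
  inverts g a b = ⟦ a < b ⟧ * ⟦ g b < g a ⟧ + ⟦ b < a ⟧ * ⟦ g a < g b ⟧

  inverts-sym : ∀ g a b → inverts g a b ≡ inverts g b a
  inverts-sym g a b = +-comm (⟦ a < b ⟧ * ⟦ g b < g a ⟧) _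

  inverts-refl : ∀ g a → inverts g a a ≡ 0
  inverts-refl g a = cong (λ x → x * ⟦ g a < g a ⟧ + x * ⟦ g a < g a ⟧) (⟦<⟧-irrefl a)

  inverts-< : ∀ g {a b} → toℕ a < toℕ b → inverts g a b ≡ ⟦ g b < g a ⟧
  inverts-< g {a} {b} a<b = begin
    inverts g a b
      ≡⟨ cong₂ (λ x y → x * ⟦ g b < g a ⟧ + y * ⟦ g a < g b ⟧) (⟦<⟧-yes a<b) (⟦<⟧-no (<-asym a<b)) ⟩
    ⟦ g b < g a ⟧ + 0 + 0
      ≡⟨ trans (+-identityʳ _) (+-identityʳ _) ⟩
    ⟦ g b < g a ⟧ ∎

  Σ²-inverts : ∀ g → Σ² (λ i j → ⟦ i < j ⟧ * inverts g i j) ≡ inversionCount g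
  Σ²-inverts g = Σ²-cong λ i j → ⟦<⟧-*-cong {i} {j} (inverts-< g)

  Σ²-inverts-permute : ∀ g (π : Permutation′ n) →
    Σ² (λ i j → ⟦ i < j ⟧ * inverts g (π ⟨$⟩ʳ i) (π ⟨$⟩ʳ j)) ≡ inversionCount g
  Σ²-inverts-permute g π = *-cancelˡ-≡ _ _ 2 (begin
    2 * Σ² (λ i j → ⟦ i < j ⟧ * inverts g (p i) (p j))
      ≡⟨ Σ²-upper (λ i j → inverts g (p i) (p j)) (λ i j → inverts-sym g (p i) (p j))
                  (inverts-refl g ∘ p) ⟩
    Σ² (λ i j → inverts g (p i) (p j))
      ≡⟨ Σ²-permute (inverts g) π ⟩
    Σ² (inverts g)
      ≡⟨ Σ²-upper (inverts g) (inverts-sym g) (inverts-refl g) ⟨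
    2 * Σ² (λ i j → ⟦ i < j ⟧ * inverts g i j)
      ≡⟨ cong (2 *_) (Σ²-inverts g) ⟩
    2 * inversionCount g ∎)
    where p = π ⟨$⟩ʳ_

  ⟨$⟩ʳ-injective : ∀ (π : Permutation′ n) {a b} → π ⟨$⟩ʳ a ≡ π ⟨$⟩ʳ b → a ≡ b
  ⟨$⟩ʳ-injective π = Injection.injective (↔⇒↣ π)

  inverts-∘-even : ∀ g {a b} → a ≢ b → g a ≢ g b → 2 ∣ ⟦ b < a ⟧ + ⟦ g b < g a ⟧ + inverts g a b
  inverts-∘-even g {a} {b} a≢b ga≢gb =
    χ-table (does (toℕ a <? toℕ b)) (does (toℕ b <? toℕ a))
            (does (toℕ (g b) <? toℕ (g a))) (does (toℕ (g a) <? toℕ (g b)))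
      (⟦<⟧-total a≢b) (⟦<⟧-total (ga≢gb ∘ sym))
    where
    χ-table : ∀ x y u v → χ x + χ y ≡ 1 → χ u + χ v ≡ 1 → 2 ∣ χ y + χ u + (χ x * χ u + χ y * χ v)
    χ-table true  true  _     _     ()
    χ-table false false _     _     ()
    χ-table _     _     true  true  _ ()
    χ-table _     _     false false _ ()
    χ-table true  false true  false _ _ = divides 1 refl
    χ-table true  false false true  _ _ = divides 0 refl
    χ-table false true  true  false _ _ = divides 1 refl
    χ-table false true  false true  _ _ = divides 1 refl

  -- For i < j, π ∘ₚ σ inverts (i, j) iff exactly one of the following holds: π inverts (i, j),
  -- σ inverts {π i, π j}.  Summed over i < j, the second kind counts the inversions of σ.
  inversionCount-∘ : ∀ (π σ : Permutation′ n) →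
    2 ∣ inversionCount (π ⟨$⟩ʳ_) + inversionCount ((π ∘ₚ σ) ⟨$⟩ʳ_) + inversionCount (σ ⟨$⟩ʳ_)
  inversionCount-∘ π σ = subst (2 ∣_) split (Σ²-even (λ i j → A i j + B i j + C i j) pair-even)
    where
    p = π ⟨$⟩ʳ_
    q = σ ⟨$⟩ʳ_
    A B C : Fin n → Fin n → ℕ
    A i j = ⟦ i < j ⟧ * ⟦ p j < p i ⟧
    B i j = ⟦ i < j ⟧ * ⟦ q (p j) < q (p i) ⟧
    C i j = ⟦ i < j ⟧ * inverts q (p i) (p j)
    pair-even : ∀ i j → 2 ∣ A i j + B i j + C i j
    pair-even i j = subst (2 ∣_) (distrib ⟦ i < j ⟧ _ _ _) (⟦<⟧-*-even {i} {j} _ λ i<j →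
      let i≢j = <⇒≢ i<j ∘ cong toℕ in
      inverts-∘-even q (i≢j ∘ ⟨$⟩ʳ-injective π) (i≢j ∘ ⟨$⟩ʳ-injective π ∘ ⟨$⟩ʳ-injective σ))
      where
      distrib : ∀ k x y z → k * (x + y + z) ≡ k * x + k * y + k * z
      distrib k x y z = trans (*-distribˡ-+ k (x + y) z) (cong (_+ k * z) (*-distribˡ-+ k x y))
    split : Σ² (λ i j → A i j + B i j + C i j)
          ≡ inversionCount p + inversionCount (q ∘ p) + inversionCount q
    split = trans (Σ²-+ (λ i j → A i j + B i j) C) (cong₂ _+_ (Σ²-+ A B) (Σ²-inverts-permute q π))

  sign : Permutation′ n → Parity
  sign π = parity (inversions π)

  sign-∘ₚ : ∀ π σ → sign (π ∘ₚ σ) ≡ sign π ℙ.+ sign σ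
  sign-∘ₚ π σ = 2∣⇒parity-rearrange (inversions π) (inversions (π ∘ₚ σ)) (inversions σ)
    (subst (2 ∣_) (sym (cong₂ _+_ (cong₂ _+_ (inv π) (inv (π ∘ₚ σ))) (inv σ))) (inversionCount-∘ π σ))
    where inv = inversions≡inversionCount

  sign-cong : ∀ {π σ} → π ≈ σ → sign π ≡ sign σ
  sign-cong {π} {σ} π≈σ = cong parity (begin
    inversions π                ≡⟨ inversions≡inversionCount π ⟩
    inversionCount (π ⟨$⟩ʳ_)    ≡⟨ Σ²-cong (λ i j → cong₂ (λ a b → ⟦ i < j ⟧ * ⟦ a < b ⟧) (π≈σ j) (π≈σ i)) ⟩
    inversionCount (σ ⟨$⟩ʳ_)    ≡⟨ inversions≡inversionCount σ ⟨
    inversions σ                ∎)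

  sign-id : sign id ≡ 0ℙ
  sign-id = trans (sign-∘ₚ id id) (p+p≡0ℙ (sign id))

  infix 10 _^ₚ_
  _^ₚ_ : Permutation′ n → ℕ → Permutation′ n
  σ ^ₚ zero  = id
  σ ^ₚ suc k = σ ∘ₚ σ ^ₚ k

  sign-^ₚ : ∀ σ k → sign (σ ^ₚ k) ≡ parity k ℙ.* sign σ
  sign-^ₚ σ zero    = sign-id
  sign-^ₚ σ (suc k) = begin
    sign (σ ∘ₚ σ ^ₚ k)                     ≡⟨ sign-∘ₚ σ (σ ^ₚ k) ⟩
    sign σ ℙ.+ sign (σ ^ₚ k)               ≡⟨ cong (sign σ ℙ.+_) (sign-^ₚ σ k) ⟩
    sign σ ℙ.+ (parity k ℙ.* sign σ)       ≡⟨ ℙₚ.*-distribʳ-+ (sign σ) 1ℙ (parity k) ⟨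
    (1ℙ ℙ.+ parity k) ℙ.* sign σ           ≡⟨ cong (ℙ._* sign σ) (+-homo-+ 1 k) ⟨
    parity (suc k) ℙ.* sign σ              ∎

  odd-order⇒sign≡0ℙ : ∀ σ {m} → ¬ 2 ∣ m → σ ^ₚ m ≈ id → sign σ ≡ 0ℙ
  odd-order⇒sign≡0ℙ σ {m} odd σᵐ≈id = begin
    sign σ                 ≡⟨ cong (ℙ._* sign σ) (¬2∣⇒parity≡1ℙ odd) ⟨
    parity m ℙ.* sign σ    ≡⟨ sign-^ₚ σ m ⟨
    sign (σ ^ₚ m)          ≡⟨ sign-cong {σ ^ₚ m} {id} σᵐ≈id ⟩
    sign id                ≡⟨ sign-id ⟩
    0ℙ                     ∎

  sign≡0ℙ⇒IsEven : ∀ π → sign π ≡ 0ℙ → IsEven π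
  sign≡0ℙ⇒IsEven π even = n∣m⇒m%n≡0 (inversions π) 2 (parity≡0ℙ⇒2∣ (inversions π) even)

-- Translations and reflections of ℤ/n

module _ {n : ℕ} .{{_ : NonZero n}} where

  infix 4 _≡ₘ_
  _≡ₘ_ : ℕ → ℕ → Set
  a ≡ₘ b = a % n ≡ b % n

  +-congₘ : ∀ {a a′ b b′} → a ≡ₘ a′ → b ≡ₘ b′ → a + b ≡ₘ a′ + b′
  +-congₘ {a} {a′} {b} {b′} a≡a′ b≡b′ = begin
    (a + b) % n              ≡⟨ %-distribˡ-+ a b n ⟩
    (a % n + b % n) % n      ≡⟨ cong₂ (λ x y → (x + y) % n) a≡a′ b≡b′ ⟩
    (a′ % n + b′ % n) % n    ≡⟨ %-distribˡ-+ a′ b′ n ⟨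
    (a′ + b′) % n            ∎

  %-≡ₘ : ∀ a → a % n ≡ₘ a
  %-≡ₘ a = m%n%n≡m%n a n

  n≡ₘ0 : n ≡ₘ 0
  n≡ₘ0 = trans (n%n≡0 n) (sym (m<n⇒m%n≡m (>-nonZero⁻¹ n)))

  ≡n⇒≡ₘ0 : ∀ {a} → a ≡ n → a ≡ₘ 0
  ≡n⇒≡ₘ0 refl = n≡ₘ0

  +-inverseₘ : ∀ a → a + (n ∸ a % n) ≡ₘ 0
  +-inverseₘ a = trans (+-congₘ {a} (sym (%-≡ₘ a)) refl) (≡n⇒≡ₘ0 (m+[n∸m]≡n (m%n≤n a n)))

  +-cancelʳₘ : ∀ {a b} c → a + c ≡ₘ b + c → a ≡ₘ b
  +-cancelʳₘ {a} {b} c a+c≡b+c = begin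
    a % n                        ≡⟨ cong (_% n) (+-identityʳ a) ⟨
    (a + 0) % n                  ≡⟨ +-congₘ {a} refl (+-inverseₘ c) ⟨
    (a + (c + d)) % n            ≡⟨ cong (_% n) (+-assoc a c d) ⟨
    (a + c + d) % n              ≡⟨ +-congₘ {a + c} a+c≡b+c refl ⟩
    (b + c + d) % n              ≡⟨ cong (_% n) (+-assoc b c d) ⟩
    (b + (c + d)) % n            ≡⟨ +-congₘ {b} refl (+-inverseₘ c) ⟩
    (b + 0) % n                  ≡⟨ cong (_% n) (+-identityʳ b) ⟩
    b % n                        ∎
    where d = n ∸ c % n

  toℕ-injectiveₘ : ∀ {x y : Fin n} → toℕ x ≡ₘ toℕ y → x ≡ y
  toℕ-injectiveₘ {x} {y} x≡y = toℕ-injective (begin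
    toℕ x        ≡⟨ m<n⇒m%n≡m (toℕ<n x) ⟨
    toℕ x % n    ≡⟨ x≡y ⟩
    toℕ y % n    ≡⟨ m<n⇒m%n≡m (toℕ<n y) ⟩
    toℕ y        ∎)

  toℕ-mod : ∀ a → toℕ (a mod n) ≡ₘ a
  toℕ-mod a = trans (cong (_% n) (toℕ-fromℕ< (m%n<n a n))) (%-≡ₘ a)

  toℕ-⊕ : ∀ (i : Fin n) a → toℕ (i ⊕ a) ≡ₘ toℕ i + a
  toℕ-⊕ i a = toℕ-mod (toℕ i + a)

  ⊕-⊕-inverse : ∀ {a b} → a + b ≡ₘ 0 → ∀ (i : Fin n) → (i ⊕ a) ⊕ b ≡ i
  ⊕-⊕-inverse {a} {b} a+b≡0 i = toℕ-injectiveₘ (begin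
    toℕ ((i ⊕ a) ⊕ b) % n     ≡⟨ trans (toℕ-⊕ (i ⊕ a) b) (+-congₘ {toℕ (i ⊕ a)} (toℕ-⊕ i a) refl) ⟩
    (toℕ i + a + b) % n       ≡⟨ trans (cong (_% n) (+-assoc (toℕ i) a b)) (+-congₘ {toℕ i} refl a+b≡0) ⟩
    (toℕ i + 0) % n           ≡⟨ cong (_% n) (+-identityʳ (toℕ i)) ⟩
    toℕ i % n                 ∎)

  translation : ℕ → Permutation′ n
  translation a = permutation (_⊕ a) (_⊕ (n ∸ a % n))
    (⊕-⊕-inverse (trans (cong (_% n) (+-comm (n ∸ a % n) a)) (+-inverseₘ a)))
    (⊕-⊕-inverse (+-inverseₘ a))

  toℕ-translation-^ₚ : ∀ a k i → toℕ (translation a ^ₚ k ⟨$⟩ʳ i) ≡ₘ toℕ i + k * a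
  toℕ-translation-^ₚ a zero    i = cong (_% n) (sym (+-identityʳ (toℕ i)))
  toℕ-translation-^ₚ a (suc k) i = begin
    toℕ (translation a ^ₚ k ⟨$⟩ʳ (i ⊕ a)) % n    ≡⟨ toℕ-translation-^ₚ a k (i ⊕ a) ⟩
    (toℕ (i ⊕ a) + k * a) % n                   ≡⟨ +-congₘ {toℕ (i ⊕ a)} (toℕ-⊕ i a) refl ⟩
    (toℕ i + a + k * a) % n                     ≡⟨ cong (_% n) (+-assoc (toℕ i) a (k * a)) ⟩
    (toℕ i + suc k * a) % n                     ∎

  translation^n≈id : ∀ a → translation a ^ₚ n ≈ id
  translation^n≈id a i = toℕ-injectiveₘ (begin
    toℕ (translation a ^ₚ n ⟨$⟩ʳ i) % n    ≡⟨ toℕ-translation-^ₚ a n i ⟩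
    (toℕ i + n * a) % n                   ≡⟨ cong (λ x → (toℕ i + x) % n) (*-comm n a) ⟩
    (toℕ i + a * n) % n                   ≡⟨ [m+kn]%n≡m%n (toℕ i) a n ⟩
    toℕ i % n                             ∎)

  sign-translation : ¬ 2 ∣ n → ∀ a → sign (translation a) ≡ 0ℙ
  sign-translation n-odd a = odd-order⇒sign≡0ℙ (translation a) n-odd (translation^n≈id a)

  reflection : ℕ → Fin n → Fin n
  reflection c i = (c + (n ∸ toℕ i)) mod n

  toℕ-reflection : ∀ c i → toℕ (reflection c i) + toℕ i ≡ₘ c
  toℕ-reflection c i = begin
    (toℕ (reflection c i) + toℕ i) % n     ≡⟨ +-congₘ {toℕ (reflection c i)} (toℕ-mod _) refl ⟩
    (c + (n ∸ toℕ i) + toℕ i) % n          ≡⟨ cong (_% n) (+-assoc c (n ∸ toℕ i) (toℕ i)) ⟩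
    (c + (n ∸ toℕ i + toℕ i)) % n          ≡⟨ +-congₘ {c} refl (≡n⇒≡ₘ0 (m∸n+n≡m (<⇒≤ (toℕ<n i)))) ⟩
    (c + 0) % n                            ≡⟨ cong (_% n) (+-identityʳ c) ⟩
    c % n                                  ∎

  reflection-unique : ∀ {c x} i → toℕ x + toℕ i ≡ₘ c → x ≡ reflection c i
  reflection-unique {c} i x+i≡c =
    toℕ-injectiveₘ (+-cancelʳₘ (toℕ i) (trans x+i≡c (sym (toℕ-reflection c i))))

  reflection-involutive : ∀ c i → reflection c (reflection c i) ≡ i
  reflection-involutive c i =
    sym (reflection-unique (reflection c i) (trans (cong (_% n) (+-comm (toℕ i) _)) (toℕ-reflection c i)))

  reflection-⊕ : ∀ c {a b} → a + b ≡ n → ∀ i → reflection c (i ⊕ a) ≡ reflection c i ⊕ b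
  reflection-⊕ c {a} {b} a+b≡n i = sym (reflection-unique (i ⊕ a) (begin
    (toℕ (r ⊕ b) + toℕ (i ⊕ a)) % n    ≡⟨ +-congₘ {toℕ (r ⊕ b)} (toℕ-⊕ r b) (toℕ-⊕ i a) ⟩
    (toℕ r + b + (toℕ i + a)) % n      ≡⟨ cong (_% n) (interchange (toℕ r) b (toℕ i) a) ⟩
    (toℕ r + toℕ i + (b + a)) % n      ≡⟨ +-congₘ {toℕ r + toℕ i} (toℕ-reflection c i) b+a≡0 ⟩
    (c + 0) % n                        ≡⟨ cong (_% n) (+-identityʳ c) ⟩
    c % n                              ∎))
    where
    r = reflection c i
    b+a≡0 = ≡n⇒≡ₘ0 (trans (+-comm b a) a+b≡n)

  toℕ-reflection-of : ∀ {c a b} i → toℕ i ≡ a → b < n → b + a ≡ c → toℕ (reflection c i) ≡ b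
  toℕ-reflection-of {c} {a} {b} i refl b<n b+a≡c = begin
    toℕ (reflection c i)        ≡⟨ m<n⇒m%n≡m (toℕ<n (reflection c i)) ⟨
    toℕ (reflection c i) % n    ≡⟨ +-cancelʳₘ (toℕ i) (trans (toℕ-reflection c i) (cong (_% n) (sym b+a≡c))) ⟩
    b % n                       ≡⟨ m<n⇒m%n≡m b<n ⟩
    b                           ∎

-- Decomposition of the generators of Γ

flipBy : Parity → Side → Side
flipBy 0ℙ s = s
flipBy 1ℙ s = swapSide s

flipBy-+ : ∀ p q s → flipBy (p ℙ.+ q) s ≡ flipBy q (flipBy p s)
flipBy-+ 0ℙ q  s  = refl
flipBy-+ 1ℙ 0ℙ s  = refl
flipBy-+ 1ℙ 1ℙ un = refl
flipBy-+ 1ℙ 1ℙ pr = refl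

flipBy-fixed : ∀ p s → flipBy p s ≡ s → p ≡ 0ℙ
flipBy-fixed 0ℙ s  _  = refl
flipBy-fixed 1ℙ un ()
flipBy-fixed 1ℙ pr ()

flips : Gen → Parity
flips g-τ = 1ℙ
flips _   = 0ℙ

flipsWord : List Gen → Parity
flipsWord []      = 0ℙ
flipsWord (g ∷ w) = flips g ℙ.+ flipsWord w

next₄ prev₄ : Fin 4 → Fin 4
next₄ 0F = 1F
next₄ 1F = 2F
next₄ 2F = 3F
next₄ 3F = 0F
prev₄ 0F = 3F
prev₄ 1F = 0F
prev₄ 2F = 1F
prev₄ 3F = 2F

position : Gen → Fin 4 → Fin 4
position g-σ₁   = next₄
position g-σ₁⁻¹ = prev₄
position g-σ₂   = next₄
position g-σ₂⁻¹ = prev₄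
position g-τ    = ρ

positionWord : List Gen → Fin 4 → Fin 4
positionWord []      k = k
positionWord (g ∷ w) k = positionWord w (position g k)

module _ (n : ℕ) .{{_ : NonZero n}} (t : ℕ) (1<t : 1 < t) (t<n : t < n) where

  swapOr : Fin n → Bool → Bool → Fin n
  swapOr i is1 ist = if is1 then t mod n else if ist then 1 mod n else i

  swapBlocks : Fin n → Fin n
  swapBlocks i = swapOr i (does (toℕ i ≟ℕ 1)) (does (toℕ i ≟ℕ t))

  τ-decomposition : ∀ s i k → τ n t (s , i , k) ≡ (swapSide s , swapBlocks i , ρ k)
  τ-decomposition s i k =
    sym (trans (if-float at b₁) (cong (if b₁ then at (t mod n) else_) (if-float at b₂)))
    where
    at : Fin n → Pt n
    at j = (swapSide s , j , ρ k)
    b₁ = does (toℕ i ≟ℕ 1)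
    b₂ = does (toℕ i ≟ℕ t)

  1<n : 1 < n
  1<n = <-trans 1<t t<n

  toℕ-t̂ : toℕ (t mod n) ≡ t
  toℕ-t̂ = trans (toℕ-fromℕ< (m%n<n t n)) (m<n⇒m%n≡m t<n)

  toℕ-1̂ : toℕ (1 mod n) ≡ 1
  toℕ-1̂ = trans (toℕ-fromℕ< (m%n<n 1 n)) (m<n⇒m%n≡m 1<n)

  swapBlocks-1 : ∀ {i} → toℕ i ≡ 1 → swapBlocks i ≡ t mod n
  swapBlocks-1 {i} i≡1 = cong (λ is1 → swapOr i is1 (does (toℕ i ≟ℕ t))) (dec-true (toℕ i ≟ℕ 1) i≡1)

  swapBlocks-t : ∀ {i} → toℕ i ≡ t → swapBlocks i ≡ 1 mod n
  swapBlocks-t {i} i≡t =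
    cong₂ (swapOr i) (dec-false (toℕ i ≟ℕ 1) λ i≡1 → <-irrefl (trans (sym i≡1) i≡t) 1<t)
                     (dec-true (toℕ i ≟ℕ t) i≡t)

  swapBlocks-other : ∀ {i} → toℕ i ≢ 1 → toℕ i ≢ t → swapBlocks i ≡ i
  swapBlocks-other {i} i≢1 i≢t =
    cong₂ (swapOr i) (dec-false (toℕ i ≟ℕ 1) i≢1) (dec-false (toℕ i ≟ℕ t) i≢t)

  swapBlocks-involutive : ∀ i → swapBlocks (swapBlocks i) ≡ i
  swapBlocks-involutive i with toℕ i ≟ℕ 1 | toℕ i ≟ℕ t
  ... | yes i≡1 | _       = toℕ-injective (begin
    toℕ (swapBlocks (swapBlocks i))  ≡⟨ cong (toℕ ∘ swapBlocks) (swapBlocks-1 i≡1) ⟩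
    toℕ (swapBlocks (t mod n))       ≡⟨ cong toℕ (swapBlocks-t toℕ-t̂) ⟩
    toℕ (1 mod n)                    ≡⟨ trans toℕ-1̂ (sym i≡1) ⟩
    toℕ i                            ∎)
  ... | no _    | yes i≡t = toℕ-injective (begin
    toℕ (swapBlocks (swapBlocks i))  ≡⟨ cong (toℕ ∘ swapBlocks) (swapBlocks-t i≡t) ⟩
    toℕ (swapBlocks (1 mod n))       ≡⟨ cong toℕ (swapBlocks-1 toℕ-1̂) ⟩
    toℕ (t mod n)                    ≡⟨ trans toℕ-t̂ (sym i≡t) ⟩
    toℕ i                            ∎)
  ... | no i≢1  | no i≢t  =
    trans (cong swapBlocks (swapBlocks-other i≢1 i≢t)) (swapBlocks-other i≢1 i≢t)

  swapBlocksₚ : Permutation′ n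
  swapBlocksₚ = permutation swapBlocks swapBlocks swapBlocks-involutive swapBlocks-involutive

  mirror : Fin n → Fin n
  mirror = reflection (1 + t)

  mirror-involutive : ∀ i → mirror (mirror i) ≡ i
  mirror-involutive = reflection-involutive (1 + t)

  mirror-injective : ∀ {i j} → mirror i ≡ mirror j → i ≡ j
  mirror-injective {i} {j} e = trans (sym (mirror-involutive i)) (trans (cong mirror e) (mirror-involutive j))

  mirror-1 : ∀ {i} → toℕ i ≡ 1 → toℕ (mirror i) ≡ t
  mirror-1 {i} i≡1 = toℕ-reflection-of i i≡1 t<n (+-comm t 1)

  mirror-t : ∀ {i} → toℕ i ≡ t → toℕ (mirror i) ≡ 1
  mirror-t {i} i≡t = toℕ-reflection-of i i≡t 1<n refl

  mirror-swapBlocks : ∀ i → mirror (swapBlocks i) ≡ swapBlocks (mirror i)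
  mirror-swapBlocks i with toℕ i ≟ℕ 1 | toℕ i ≟ℕ t
  ... | yes i≡1 | _       = toℕ-injective (begin
    toℕ (mirror (swapBlocks i))   ≡⟨ cong (toℕ ∘ mirror) (swapBlocks-1 i≡1) ⟩
    toℕ (mirror (t mod n))        ≡⟨ mirror-t toℕ-t̂ ⟩
    1                             ≡⟨ toℕ-1̂ ⟨
    toℕ (1 mod n)                 ≡⟨ cong toℕ (swapBlocks-t (mirror-1 i≡1)) ⟨
    toℕ (swapBlocks (mirror i))   ∎)
  ... | no _    | yes i≡t = toℕ-injective (begin
    toℕ (mirror (swapBlocks i))   ≡⟨ cong (toℕ ∘ mirror) (swapBlocks-t i≡t) ⟩
    toℕ (mirror (1 mod n))        ≡⟨ mirror-1 toℕ-1̂ ⟩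
    t                             ≡⟨ toℕ-t̂ ⟨
    toℕ (t mod n)                 ≡⟨ cong toℕ (swapBlocks-1 (mirror-t i≡t)) ⟨
    toℕ (swapBlocks (mirror i))   ∎)
  ... | no i≢1  | no i≢t  =
    trans (cong mirror (swapBlocks-other i≢1 i≢t)) (sym (swapBlocks-other mi≢1 mi≢t))
    where
    mi≢1 : toℕ (mirror i) ≢ 1
    mi≢1 mi≡1 = i≢t (trans (cong toℕ (sym (mirror-involutive i))) (mirror-1 mi≡1))
    mi≢t : toℕ (mirror i) ≢ t
    mi≢t mi≡t = i≢1 (trans (cong toℕ (sym (mirror-involutive i))) (mirror-t mi≡t))

  σ₂-shift σ₂⁻¹-shift : Fin 4 → ℕ
  σ₂-shift 0F = t
  σ₂-shift 1F = 1
  σ₂-shift 2F = n ∸ t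
  σ₂-shift 3F = n ∸ 1
  σ₂⁻¹-shift 0F = 1
  σ₂⁻¹-shift 1F = n ∸ t
  σ₂⁻¹-shift 2F = n ∸ 1
  σ₂⁻¹-shift 3F = t

  block : Gen → Fin 4 → Permutation′ n
  block g-σ₁   _ = id
  block g-σ₁⁻¹ _ = id
  block g-σ₂   k = translation (σ₂-shift k)
  block g-σ₂⁻¹ k = translation (σ₂⁻¹-shift k)
  block g-τ    _ = swapBlocksₚ

  ⟦⟧g-decomposition : ∀ g s i k →
    ⟦ g ⟧g n t (s , i , k) ≡ (flipBy (flips g) s , block g k ⟨$⟩ʳ i , position g k)
  ⟦⟧g-decomposition g-σ₁   s i 0F = refl
  ⟦⟧g-decomposition g-σ₁   s i 1F = refl
  ⟦⟧g-decomposition g-σ₁   s i 2F = refl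
  ⟦⟧g-decomposition g-σ₁   s i 3F = refl
  ⟦⟧g-decomposition g-σ₁⁻¹ s i 0F = refl
  ⟦⟧g-decomposition g-σ₁⁻¹ s i 1F = refl
  ⟦⟧g-decomposition g-σ₁⁻¹ s i 2F = refl
  ⟦⟧g-decomposition g-σ₁⁻¹ s i 3F = refl
  ⟦⟧g-decomposition g-σ₂   s i 0F = refl
  ⟦⟧g-decomposition g-σ₂   s i 1F = refl
  ⟦⟧g-decomposition g-σ₂   s i 2F = refl
  ⟦⟧g-decomposition g-σ₂   s i 3F = refl
  ⟦⟧g-decomposition g-σ₂⁻¹ s i 0F = refl
  ⟦⟧g-decomposition g-σ₂⁻¹ s i 1F = refl
  ⟦⟧g-decomposition g-σ₂⁻¹ s i 2F = refl
  ⟦⟧g-decomposition g-σ₂⁻¹ s i 3F = refl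
  ⟦⟧g-decomposition g-τ    s i k  = τ-decomposition s i k

  blockWord : List Gen → Fin 4 → Permutation′ n
  blockWord []      k = id
  blockWord (g ∷ w) k = block g k ∘ₚ blockWord w (position g k)

  evalWord-decomposition : ∀ w s i k →
    evalWord n t w (s , i , k) ≡ (flipBy (flipsWord w) s , blockWord w k ⟨$⟩ʳ i , positionWord w k)
  evalWord-decomposition []      s i k = refl
  evalWord-decomposition (g ∷ w) s i k = begin
    evalWord n t w (⟦ g ⟧g n t (s , i , k))
      ≡⟨ cong (evalWord n t w) (⟦⟧g-decomposition g s i k) ⟩
    evalWord n t w (flipBy (flips g) s , block g k ⟨$⟩ʳ i , position g k)
      ≡⟨ evalWord-decomposition w (flipBy (flips g) s) (block g k ⟨$⟩ʳ i) (position g k) ⟩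
    (flipBy (flipsWord w) (flipBy (flips g) s) , rest)
      ≡⟨ cong (_, rest) (flipBy-+ (flips g) (flipsWord w) s) ⟨
    (flipBy (flipsWord (g ∷ w)) s , rest) ∎
    where rest = (blockWord (g ∷ w) k ⟨$⟩ʳ i , positionWord (g ∷ w) k)

  module _ (n-odd : ¬ 2 ∣ n) where

    sign-block : ∀ g k → sign (block g k) ≡ flips g ℙ.* sign swapBlocksₚ
    sign-block g-σ₁   _ = sign-id {n}
    sign-block g-σ₁⁻¹ _ = sign-id {n}
    sign-block g-σ₂   k = sign-translation n-odd (σ₂-shift k)
    sign-block g-σ₂⁻¹ k = sign-translation n-odd (σ₂⁻¹-shift k)
    sign-block g-τ    _ = refl

    sign-blockWord : ∀ w k → sign (blockWord w k) ≡ flipsWord w ℙ.* sign swapBlocksₚ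
    sign-blockWord []      k = sign-id {n}
    sign-blockWord (g ∷ w) k = begin
      sign (block g k ∘ₚ blockWord w (position g k))
        ≡⟨ sign-∘ₚ (block g k) (blockWord w (position g k)) ⟩
      sign (block g k) ℙ.+ sign (blockWord w (position g k))
        ≡⟨ cong₂ ℙ._+_ (sign-block g k) (sign-blockWord w (position g k)) ⟩
      (flips g ℙ.* sign swapBlocksₚ) ℙ.+ (flipsWord w ℙ.* sign swapBlocksₚ)
        ≡⟨ ℙₚ.*-distribʳ-+ (sign swapBlocksₚ) (flips g) (flipsWord w) ⟨
      flipsWord (g ∷ w) ℙ.* sign swapBlocksₚ ∎

  -- The fibres of ν, {(s, x, k), (s, mirror x, k + 2) | s ∈ {un, pr}} for k < 2, form a block
  -- system of Γ.
  mirrorOf : Fin 4 → Fin n → Fin n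
  mirrorOf 0F = λ i → i
  mirrorOf 1F = λ i → i
  mirrorOf 2F = mirror
  mirrorOf 3F = mirror

  mirrorOf-injective : ∀ k {i j} → mirrorOf k i ≡ mirrorOf k j → i ≡ j
  mirrorOf-injective 0F e = e
  mirrorOf-injective 1F e = e
  mirrorOf-injective 2F e = mirror-injective e
  mirrorOf-injective 3F e = mirror-injective e

  ν : Pt n → Parity × Fin n
  ν (_ , i , k) = (parity (toℕ k) , mirrorOf k i)

  quotientAction : Gen → Parity × Fin n → Parity × Fin n
  quotientAction g-σ₁   (0ℙ , x) = (1ℙ , x)
  quotientAction g-σ₁   (1ℙ , x) = (0ℙ , mirror x)
  quotientAction g-σ₁⁻¹ (0ℙ , x) = (1ℙ , mirror x)
  quotientAction g-σ₁⁻¹ (1ℙ , x) = (0ℙ , x)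
  quotientAction g-σ₂   (0ℙ , x) = (1ℙ , x ⊕ t)
  quotientAction g-σ₂   (1ℙ , x) = (0ℙ , mirror (x ⊕ 1))
  quotientAction g-σ₂⁻¹ (0ℙ , x) = (1ℙ , mirror (x ⊕ 1))
  quotientAction g-σ₂⁻¹ (1ℙ , x) = (0ℙ , x ⊕ (n ∸ t))
  quotientAction g-τ    (0ℙ , x) = (0ℙ , swapBlocks x)
  quotientAction g-τ    (1ℙ , x) = (1ℙ , mirror (swapBlocks x))

  mirror-⊕1 : ∀ i → mirror (mirror i ⊕ 1) ≡ i ⊕ (n ∸ 1)
  mirror-⊕1 i = trans (reflection-⊕ (1 + t) (m+[n∸m]≡n (<⇒≤ 1<n)) (mirror i))
                      (cong (_⊕ (n ∸ 1)) (mirror-involutive i))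

  ν-equivariant : ∀ g x → ν (⟦ g ⟧g n t x) ≡ quotientAction g (ν x)
  ν-equivariant g-σ₁   (s , i , 0F) = refl
  ν-equivariant g-σ₁   (s , i , 1F) = refl
  ν-equivariant g-σ₁   (s , i , 2F) = refl
  ν-equivariant g-σ₁   (s , i , 3F) = cong (0ℙ ,_) (sym (mirror-involutive i))
  ν-equivariant g-σ₁⁻¹ (s , i , 0F) = refl
  ν-equivariant g-σ₁⁻¹ (s , i , 1F) = refl
  ν-equivariant g-σ₁⁻¹ (s , i , 2F) = cong (1ℙ ,_) (sym (mirror-involutive i))
  ν-equivariant g-σ₁⁻¹ (s , i , 3F) = refl
  ν-equivariant g-σ₂   (s , i , 0F) = refl
  ν-equivariant g-σ₂   (s , i , 1F) = refl
  ν-equivariant g-σ₂   (s , i , 2F) = cong (1ℙ ,_) (reflection-⊕ (1 + t) (m∸n+n≡m (<⇒≤ t<n)) i)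
  ν-equivariant g-σ₂   (s , i , 3F) = cong (0ℙ ,_) (sym (mirror-⊕1 i))
  ν-equivariant g-σ₂⁻¹ (s , i , 0F) = refl
  ν-equivariant g-σ₂⁻¹ (s , i , 1F) = refl
  ν-equivariant g-σ₂⁻¹ (s , i , 2F) = cong (1ℙ ,_) (sym (mirror-⊕1 i))
  ν-equivariant g-σ₂⁻¹ (s , i , 3F) = cong (0ℙ ,_) (reflection-⊕ (1 + t) (m+[n∸m]≡n (<⇒≤ t<n)) i)
  ν-equivariant g-τ    (s , i , k)  = trans (cong ν (τ-decomposition s i k)) (τ-case k)
    where
    τ-case : ∀ k → ν (swapSide s , swapBlocks i , ρ k) ≡ quotientAction g-τ (ν (s , i , k))
    τ-case 0F = refl
    τ-case 1F = refl
    τ-case 2F = cong (0ℙ ,_) (mirror-swapBlocks i)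
    τ-case 3F = cong (1ℙ ,_) (begin
      swapBlocks i                    ≡⟨ cong swapBlocks (mirror-involutive i) ⟨
      swapBlocks (mirror (mirror i))  ≡⟨ mirror-swapBlocks (mirror i) ⟨
      mirror (swapBlocks (mirror i))  ∎)

  quotientActionWord : List Gen → Parity × Fin n → Parity × Fin n
  quotientActionWord []      = λ q → q
  quotientActionWord (g ∷ w) = quotientActionWord w ∘ quotientAction g

  ν-evalWord : ∀ w x → ν (evalWord n t w x) ≡ quotientActionWord w (ν x)
  ν-evalWord []      x = refl
  ν-evalWord (g ∷ w) x =
    trans (ν-evalWord w (⟦ g ⟧g n t x)) (cong (quotientActionWord w) (ν-equivariant g x))

  classOf : Parity → Fin 4
  classOf 0ℙ = 0F
  classOf 1ℙ = 1F

  blockIndex : Pt n → Fin n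
  blockIndex = proj₁ ∘ proj₂

  module Λ-element {f : Pt n → Pt n} (f∈Λ : InΛ n t f) where

    word : List Gen
    word = proj₁ (proj₁ f∈Λ)

    f≗word : ∀ x → f x ≡ evalWord n t word x
    f≗word = proj₂ (proj₁ f∈Λ)

    restriction : Fin 4 → Permutation′ n
    restriction = blockWord word

    f-shape : ∀ s i k → f (s , i , k) ≡ (s , restriction k ⟨$⟩ʳ i , k)
    f-shape s i k = cong₂ _,_ (proj₁ stays) (cong₂ _,_ moves (proj₂ stays))
      where
      stays = proj₁ (proj₂ f∈Λ s k) i
      moves = cong blockIndex (trans (f≗word (s , i , k)) (evalWord-decomposition word s i k))

    flipsWord≡0ℙ : flipsWord word ≡ 0ℙ
    flipsWord≡0ℙ = flipBy-fixed (flipsWord word) un (begin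
      flipBy (flipsWord word) un   ≡⟨ cong proj₁ (evalWord-decomposition word un i₀ 0F) ⟨
      proj₁ (evalWord n t word x)  ≡⟨ cong proj₁ (f≗word x) ⟨
      proj₁ (f x)                  ≡⟨ cong proj₁ (f-shape un i₀ 0F) ⟩
      un                           ∎)
      where
      i₀ = 0 mod n
      x = (un , i₀ , 0F)

    mirrorOf-restriction : ∀ k i →
      mirrorOf k (restriction k ⟨$⟩ʳ i) ≡ proj₂ (quotientActionWord word (parity (toℕ k) , mirrorOf k i))
    mirrorOf-restriction k i = cong proj₂ (begin
      ν (un , restriction k ⟨$⟩ʳ i , k)          ≡⟨ cong ν (f-shape un i k) ⟨
      ν (f (un , i , k))                         ≡⟨ cong ν (f≗word (un , i , k)) ⟩
      ν (evalWord n t word (un , i , k))         ≡⟨ ν-evalWord word (un , i , k) ⟩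
      quotientActionWord word (ν (un , i , k))   ∎)

    restriction-conjugate : ∀ k i →
      mirrorOf k (restriction k ⟨$⟩ʳ i) ≡ restriction (classOf (parity (toℕ k))) ⟨$⟩ʳ mirrorOf k i
    restriction-conjugate k i = trans (mirrorOf-restriction k i) (quotient-restriction _ (mirrorOf k i))
      where
      quotient-restriction : ∀ p x → proj₂ (quotientActionWord word (p , x)) ≡ restriction (classOf p) ⟨$⟩ʳ x
      quotient-restriction 0ℙ x = sym (mirrorOf-restriction 0F x)
      quotient-restriction 1ℙ x = sym (mirrorOf-restriction 1F x)

  open Λ-element

  restrictions : (f : Pt n → Pt n) → InΛ n t f → Permutation′ n × Permutation′ n
  restrictions f f∈Λ = restriction f∈Λ 0F , restriction f∈Λ 1F

  restriction-even : ¬ 2 ∣ n → ∀ {f} (f∈Λ : InΛ n t f) k → IsEven (restriction f∈Λ k)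
  restriction-even n-odd f∈Λ k = sign≡0ℙ⇒IsEven (restriction f∈Λ k)
    (trans (sign-blockWord n-odd (word f∈Λ) k) (cong (ℙ._* sign swapBlocksₚ) (flipsWord≡0ℙ f∈Λ)))

  module _ {f g : Pt n → Pt n} (f∈Λ : InΛ n t f) (g∈Λ : InΛ n t g) where

    restriction-cong : (∀ x → f x ≡ g x) → ∀ k → restriction f∈Λ k ≈ restriction g∈Λ k
    restriction-cong f≗g k i = begin
      restriction f∈Λ k ⟨$⟩ʳ i   ≡⟨ cong blockIndex (f-shape f∈Λ un i k) ⟨
      blockIndex (f (un , i , k)) ≡⟨ cong blockIndex (f≗g (un , i , k)) ⟩
      blockIndex (g (un , i , k)) ≡⟨ cong blockIndex (f-shape g∈Λ un i k) ⟩
      restriction g∈Λ k ⟨$⟩ʳ i   ∎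

    restriction-∘ : ∀ {h : Pt n → Pt n} (h∈Λ : InΛ n t h) → (∀ x → h x ≡ g (f x)) →
      ∀ k → restriction h∈Λ k ≈ restriction f∈Λ k ∘ₚ restriction g∈Λ k
    restriction-∘ {h} h∈Λ h≗g∘f k i = begin
      restriction h∈Λ k ⟨$⟩ʳ i                             ≡⟨ cong blockIndex (f-shape h∈Λ un i k) ⟨
      blockIndex (h (un , i , k))                          ≡⟨ cong blockIndex (h≗g∘f (un , i , k)) ⟩
      blockIndex (g (f (un , i , k)))                      ≡⟨ cong (blockIndex ∘ g) (f-shape f∈Λ un i k) ⟩
      blockIndex (g (un , restriction f∈Λ k ⟨$⟩ʳ i , k))   ≡⟨ cong blockIndex (f-shape g∈Λ un _ k) ⟩
      restriction g∈Λ k ⟨$⟩ʳ (restriction f∈Λ k ⟨$⟩ʳ i)   ∎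

    ≗-from-restrictions : (∀ p → restriction f∈Λ (classOf p) ≈ restriction g∈Λ (classOf p)) →
      ∀ x → f x ≡ g x
    ≗-from-restrictions same (s , i , k) = begin
      f (s , i , k)                          ≡⟨ f-shape f∈Λ s i k ⟩
      (s , restriction f∈Λ k ⟨$⟩ʳ i , k)     ≡⟨ cong (λ j → (s , j , k)) same-block ⟩
      (s , restriction g∈Λ k ⟨$⟩ʳ i , k)     ≡⟨ f-shape g∈Λ s i k ⟨
      g (s , i , k)                          ∎
      where
      p = parity (toℕ k)
      same-block : restriction f∈Λ k ⟨$⟩ʳ i ≡ restriction g∈Λ k ⟨$⟩ʳ i
      same-block = mirrorOf-injective k (begin
        mirrorOf k (restriction f∈Λ k ⟨$⟩ʳ i)            ≡⟨ restriction-conjugate f∈Λ k i ⟩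
        restriction f∈Λ (classOf p) ⟨$⟩ʳ mirrorOf k i    ≡⟨ same p (mirrorOf k i) ⟩
        restriction g∈Λ (classOf p) ⟨$⟩ʳ mirrorOf k i    ≡⟨ restriction-conjugate g∈Λ k i ⟨
        mirrorOf k (restriction g∈Λ k ⟨$⟩ʳ i)            ∎)

  embedding : ¬ 2 ∣ n → EmbedsInAn×An n t
  embedding n-odd =
    restrictions ,
    (λ f f∈Λ → restriction-even n-odd f∈Λ 0F , restriction-even n-odd f∈Λ 1F) ,
    (λ f g f∈Λ g∈Λ f≗g → restriction-cong f∈Λ g∈Λ f≗g 0F , restriction-cong f∈Λ g∈Λ f≗g 1F) ,
    (λ f g h f∈Λ g∈Λ h∈Λ h≗g∘f → restriction-∘ f∈Λ g∈Λ h∈Λ h≗g∘f 0F , restriction-∘ f∈Λ g∈Λ h∈Λ h≗g∘f 1F) ,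
    (λ f g f∈Λ g∈Λ same₀ same₁ → ≗-from-restrictions f∈Λ g∈Λ λ { 0ℙ → same₀ ; 1ℙ → same₁ })

prime≢2⇒odd : ∀ {p} → Prime p → p ≢ 2 → ¬ 2 ∣ p
prime≢2⇒odd p-prime p≢2 2∣p with prime⇒irreducible p-prime 2∣p
... | inj₂ 2≡p = p≢2 (sym 2≡p)

t<n×n≢2 : ∀ n {t} → 2 ≤ t → t ≤ n ∸ 2 → t < n × n ≢ 2
t<n×n≢2 0             2≤t t≤0 = ⊥-elim (n≮0 (≤-trans 2≤t t≤0))
t<n×n≢2 1             2≤t t≤0 = ⊥-elim (n≮0 (≤-trans 2≤t t≤0))
t<n×n≢2 (suc (suc m)) 2≤t t≤m = s≤s (m≤n⇒m≤1+n t≤m) , λ { refl → n≮0 (≤-trans 2≤t t≤m) }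

lemma5p3 : (b c : ℤ) (n : ℕ) .{{_ : NonZero n}} →
    + n ≡ b *ℤ b +ℤ c *ℤ c → Prime n → Chiral44 b c →
    (t : ℕ) → 2 ≤ t → t ≤ n ∸ 2 → n ∣ t * t + 1 →
    (t % 4 ≡ 0 ⊎ t % 4 ≡ 3) →
    EmbedsInAn×An n t
lemma5p3 b c n _ n-prime _ t 2≤t t≤n∸2 _ _ =
  embedding n t 2≤t t<n (prime≢2⇒odd n-prime n≢2)
  where
  t<n = proj₁ (t<n×n≢2 n 2≤t t≤n∸2)
  n≢2 = proj₂ (t<n×n≢2 n 2≤t t≤n∸2)
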